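{- Let $b\ge 2$ be an integer and define $(h_{1,b}(n))_{n\in\mathbb{N}}$ by $h_{1,b}(n)=1$ for integers $n\le 0$, $h_{1,b}(1)=b$, and $h_{1,b}(n)=h_{1,b}(n-h_{1,b}(n-1))+h_{1,b}(n-2)$ for $n>1$. Then for all $n\in\mathbb{N}$, $$h_{1,b}(2n)=n+1,$$ for all $n\ge1$, $$h_{1,b}(2n+1)=h_{1,b}(n)+h_{1,b}(2n-1),$$ and for all $n\in\mathbb{N}$, $$h_{1,b}(2n+1)=b-1+\sum_{i=0}^n h_{1,b}(i).$$ -}

module Defs where

open import Data.Nat using (ℕ; zero; suc)
open import Data.Integer using (ℤ; +_; _+_; _-_; _≤_; _>_; 1ℤ)
open import Data.Product using (_×_)
open import Relation.Binary.PropositionalEquality using (_≡_)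

IsH : ℕ → (ℤ → ℤ) → Set
IsH b h =
  (∀ (n : ℤ) → n ≤ + 0 → h n ≡ 1ℤ) ×
  (h (+ 1) ≡ + b) ×
  (∀ (n : ℤ) → n > + 1 → h n ≡ h (n - h (n - 1ℤ)) + h (n - + 2))

sumTo : (ℤ → ℤ) → ℕ → ℤ
sumTo h zero = h (+ 0)
sumTo h (suc n) = sumTo h n + h (+ suc n)

{-# OPTIONS --safe #-}
module Submission where

-- As long as a solution h stays positive, the index n - h(n-1) in the recurrence lies below n,
-- so the recurrence determines h by strong induction; positivity propagates the same way.
-- A solution exists: define h on ℕ by well-founded recursion from the rules h(2m) = m+1,
-- h(1) = b, h(2m+3) = h(m+1) + h(2m+1).  Since b ≥ 2 these give h(2m+1) ≥ 2m+2, so at the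
-- even argument 2m+2 the recurrence reads h(≤ 0) + h(2m) = 1 + (m+1), while at the odd
-- argument 2m+3 it reads h(2m+3 - (m+2)) + h(2m+1).  The sum formula telescopes the odd rule.

open import Defs
open import Data.Nat using (ℕ; zero; suc; _≤_; _<_; _*_; z≤n; s≤s)
import Data.Nat as ℕ
import Data.Nat.Properties as ℕ
open import Data.Nat.Properties using (n<1+n; m<n⇒m<1+n; ≤-trans; n≤1+n; m≤n⇒m≤1+n; m≤n+m; +-mono-≤; <⇒≤)
open import Data.Nat.Induction using (<-rec; <-wellFounded)
open import Data.Integer as ℤ using (ℤ; +_; -[1+_]; _+_; _-_; 0ℤ; 1ℤ; _⊖_; +≤+; +<+; -≤+)
import Data.Integer.Properties as ℤ
open import Data.Integer.Properties using (m⊖1+n<m; [+m]-[+n]≡m⊖n; ⊖-≥; i≤j⇒i-j≤0; pos-+; +-mono-<)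
open import Data.Product using (_×_; Σ; _,_)
open import Function using (_∘_)
open import Induction.WellFounded using (WfRec; module FixPoint)
open import Relation.Binary.PropositionalEquality
  using (_≡_; refl; sym; trans; cong; cong₂; subst; module ≡-Reasoning)

double : ℕ → ℕ
double zero    = zero
double (suc m) = suc (suc (double m))

double≡2* : ∀ m → double m ≡ 2 * m
double≡2* zero    = refl
double≡2* (suc m) = trans (cong (suc ∘ suc) (double≡2* m)) (sym (ℕ.*-suc 2 m))

2*m+1≡1+double : ∀ m → 2 * m ℕ.+ 1 ≡ suc (double m)
2*m+1≡1+double m = trans (ℕ.+-comm (2 * m) 1) (cong suc (sym (double≡2* m)))

m≤double : ∀ m → m ≤ double m
m≤double zero    = z≤n
m≤double (suc m) = s≤s (m≤n⇒m≤1+n (m≤double m))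

data Parity : ℕ → Set where
  even : ∀ m → Parity (double m)
  odd  : ∀ m → Parity (suc (double m))

parity-suc-suc : ∀ {n} → Parity n → Parity (suc (suc n))
parity-suc-suc (even m) = even (suc m)
parity-suc-suc (odd m)  = odd (suc m)

parity : ∀ n → Parity n
parity zero          = even zero
parity (suc zero)    = odd zero
parity (suc (suc n)) = parity-suc-suc (parity n)

parity-double : ∀ m → parity (double m) ≡ even m
parity-double zero    = refl
parity-double (suc m) = cong parity-suc-suc (parity-double m)

parity-1+double : ∀ m → parity (suc (double m)) ≡ odd m
parity-1+double zero    = refl
parity-1+double (suc m) = cong parity-suc-suc (parity-1+double m)

parity-unique : ∀ {n} (p : Parity n) → parity n ≡ p
parity-unique (even m) = parity-double m
parity-unique (odd m)  = parity-1+double m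

1+m<1+double[1+m] : ∀ m → suc m < suc (double (suc m))
1+m<1+double[1+m] m = s≤s (s≤s (m≤n⇒m≤1+n (m≤double m)))

1+double<1+double[1+m] : ∀ m → suc (double m) < suc (double (suc m))
1+double<1+double[1+m] m = n≤1+n _

[m+n]-n≡m : ∀ m n → + (m ℕ.+ n) - + n ≡ + m
[m+n]-n≡m m n = begin
  + (m ℕ.+ n) - + n   ≡⟨ [+m]-[+n]≡m⊖n (m ℕ.+ n) n ⟩
  (m ℕ.+ n) ⊖ n       ≡⟨ ⊖-≥ (m≤n+m n m) ⟩
  + (m ℕ.+ n ℕ.∸ n)   ≡⟨ cong +_ (ℕ.m+n∸n≡m m n) ⟩
  + m                 ∎
  where open ≡-Reasoning

1+double[1+m]-[2+m]≡1+m : ∀ m → + suc (double (suc m)) - + suc (suc m) ≡ + suc m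
1+double[1+m]-[2+m]≡1+m m =
  trans (cong (λ k → + k - + suc (suc m)) 3+double≡1+m+2+m) ([m+n]-n≡m (suc m) (suc (suc m)))
  where
  3+double≡1+m+2+m : suc (double (suc m)) ≡ suc m ℕ.+ suc (suc m)
  3+double≡1+m+2+m = cong suc (begin
    suc (suc (double m))     ≡⟨ cong (suc ∘ suc) (trans (double≡2* m) (cong (m ℕ.+_) (ℕ.+-identityʳ m))) ⟩
    suc (suc (m ℕ.+ m))      ≡⟨ cong suc (sym (ℕ.+-suc m m)) ⟩
    suc (m ℕ.+ suc m)        ≡⟨ sym (ℕ.+-suc m (suc m)) ⟩
    m ℕ.+ suc (suc m)        ∎)
    where open ≡-Reasoning

+n-j<+n : ∀ n {j} → 0ℤ ℤ.< j → + n - j ℤ.< + n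
+n-j<+n n {+ suc k} _ = m⊖1+n<m n (suc k)
+n-j<+n n {+ zero} (+<+ ())

ℤ-<-rec : (P : ℤ → Set) → (∀ m → P -[1+ m ]) →
          (∀ n → (∀ i → i ℤ.< + n → P i) → P (+ n)) → ∀ i → P i
ℤ-<-rec P negative step -[1+ m ] = negative m
ℤ-<-rec P negative step (+ n)    = <-rec (P ∘ +_) (λ n rec → step n (below rec)) n
  where
  below : ∀ {n} → (∀ {m} → m < n → P (+ m)) → ∀ i → i ℤ.< + n → P i
  below rec (+ m)     (+<+ m<n) = rec m<n
  below rec -[1+ m ] _         = negative m

module _ {b : ℕ} where

  IsH-positive : 1 ≤ b → {h : ℤ → ℤ} → IsH b h → ∀ i → 0ℤ ℤ.< h i
  IsH-positive 1≤b {h} (init , h1≡b , recurrence) = ℤ-<-rec _ (λ m → positive-init -[1+ m ] -≤+) positive-at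
    where
    positive-init : ∀ i → i ℤ.≤ + 0 → 0ℤ ℤ.< h i
    positive-init i i≤0 = subst (0ℤ ℤ.<_) (sym (init i i≤0)) (+<+ (s≤s z≤n))
    positive-at : ∀ n → (∀ i → i ℤ.< + n → 0ℤ ℤ.< h i) → 0ℤ ℤ.< h (+ n)
    positive-at zero          _   = positive-init (+ 0) (+≤+ z≤n)
    positive-at (suc zero)    _   = subst (0ℤ ℤ.<_) (sym h1≡b) (+<+ 1≤b)
    positive-at (suc (suc k)) rec = subst (0ℤ ℤ.<_) (sym (recurrence (+ suc (suc k)) (+<+ (s≤s (s≤s z≤n)))))
      (+-mono-< (rec _ (+n-j<+n (suc (suc k)) (rec (+ suc k) (+<+ (n<1+n (suc k))))))
                (rec (+ k) (+<+ (m<n⇒m<1+n (n<1+n k)))))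

  IsH-unique : 1 ≤ b → {h h′ : ℤ → ℤ} → IsH b h → IsH b h′ → ∀ i → h i ≡ h′ i
  IsH-unique 1≤b {h} {h′} (init , h1≡b , recurrence) H′@(init′ , h′1≡b , recurrence′) =
    ℤ-<-rec _ (λ m → agree-init -[1+ m ] -≤+) agree-at
    where
    agree-init : ∀ i → i ℤ.≤ + 0 → h i ≡ h′ i
    agree-init i i≤0 = trans (init i i≤0) (sym (init′ i i≤0))
    agree-at : ∀ n → (∀ i → i ℤ.< + n → h i ≡ h′ i) → h (+ n) ≡ h′ (+ n)
    agree-at zero          _   = agree-init (+ 0) (+≤+ z≤n)
    agree-at (suc zero)    _   = trans h1≡b (sym h′1≡b)
    agree-at (suc (suc k)) rec = begin
      h (+ n)                               ≡⟨ recurrence (+ n) n>1 ⟩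
      h (+ n - h (+ suc k)) + h (+ k)       ≡⟨ cong (λ j → h (+ n - j) + h (+ k)) (rec (+ suc k) (+<+ (n<1+n (suc k)))) ⟩
      h (+ n - h′ (+ suc k)) + h (+ k)      ≡⟨ cong₂ _+_ (rec _ index<n) (rec (+ k) (+<+ (m<n⇒m<1+n (n<1+n k)))) ⟩
      h′ (+ n - h′ (+ suc k)) + h′ (+ k)    ≡⟨ sym (recurrence′ (+ n) n>1) ⟩
      h′ (+ n)                              ∎
      where
      open ≡-Reasoning
      n : ℕ
      n = suc (suc k)
      n>1 : + n ℤ.> + 1
      n>1 = +<+ (s≤s (s≤s z≤n))
      index<n : + n - h′ (+ suc k) ℤ.< + n
      index<n = +n-j<+n n (IsH-positive 1≤b H′ (+ suc k))

  IsH-odd-sum : {h : ℤ → ℤ} → IsH b h →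
    ((n : ℕ) → 1 ≤ n → h (+ (2 * n ℕ.+ 1)) ≡ h (+ n) + h (+ (2 * n) - 1ℤ)) →
    ∀ n → h (+ (2 * n ℕ.+ 1)) ≡ (+ b - 1ℤ) + sumTo h n
  IsH-odd-sum {h} (init , h1≡b , _) odd-rule zero = begin
    h (+ 1)                   ≡⟨ h1≡b ⟩
    + b                       ≡⟨ sym (ℤ.+-identityʳ (+ b)) ⟩
    + b + 0ℤ                  ≡⟨ cong (λ i → + b + i) (sym (ℤ.+-inverseˡ 1ℤ)) ⟩
    + b + (ℤ.- 1ℤ + 1ℤ)       ≡⟨ sym (ℤ.+-assoc (+ b) (ℤ.- 1ℤ) 1ℤ) ⟩
    (+ b - 1ℤ) + 1ℤ           ≡⟨ cong (λ i → (+ b - 1ℤ) + i) (sym (init (+ 0) (+≤+ z≤n))) ⟩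
    (+ b - 1ℤ) + h (+ 0)      ∎
    where open ≡-Reasoning
  IsH-odd-sum {h} H odd-rule (suc m) = begin
    h (+ (2 * suc m ℕ.+ 1))                   ≡⟨ odd-rule (suc m) (s≤s z≤n) ⟩
    h (+ suc m) + h (+ (2 * suc m) - 1ℤ)      ≡⟨ cong (λ k → h (+ suc m) + h (+ k - 1ℤ)) (ℕ.*-suc 2 m) ⟩
    h (+ suc m) + h (+ suc (2 * m))           ≡⟨ cong (λ k → h (+ suc m) + h (+ k)) (ℕ.+-comm 1 (2 * m)) ⟩
    h (+ suc m) + h (+ (2 * m ℕ.+ 1))         ≡⟨ cong (λ i → h (+ suc m) + i) (IsH-odd-sum H odd-rule m) ⟩
    h (+ suc m) + ((+ b - 1ℤ) + sumTo h m)    ≡⟨ ℤ.+-comm (h (+ suc m)) _ ⟩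
    (+ b - 1ℤ) + sumTo h m + h (+ suc m)      ≡⟨ ℤ.+-assoc (+ b - 1ℤ) (sumTo h m) _ ⟩
    (+ b - 1ℤ) + sumTo h (suc m)              ∎
    where open ≡-Reasoning

module Construction (b : ℕ) where

  private
    step : ∀ {n} → Parity n → WfRec _<_ (λ _ → ℕ) n → ℕ
    step (even m)      _   = suc m
    step (odd zero)    _   = b
    step (odd (suc m)) rec = rec (1+m<1+double[1+m] m) ℕ.+ rec (1+double<1+double[1+m] m)

    step-ext : ∀ {n} (p : Parity n) {rec rec′ : WfRec _<_ (λ _ → ℕ) n} →
               (∀ {m} (m<n : m < n) → rec m<n ≡ rec′ m<n) → step p rec ≡ step p rec′
    step-ext (even m)      eq = refl
    step-ext (odd zero)    eq = refl
    step-ext (odd (suc m)) eq = cong₂ ℕ._+_ (eq _) (eq _)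

    open FixPoint <-wellFounded (λ _ → ℕ) (λ n → step (parity n)) (λ n → step-ext (parity n))

  hℕ : ℕ → ℕ
  hℕ = <-rec (λ _ → ℕ) (λ n → step (parity n))

  private
    hℕ-unfold : ∀ {n} (p : Parity n) → hℕ n ≡ step p (λ {m} _ → hℕ m)
    hℕ-unfold {n} p = trans (unfold-wfRec {n}) (cong (λ q → step q (λ {m} _ → hℕ m)) (parity-unique p))

  hℕ-double : ∀ m → hℕ (double m) ≡ suc m
  hℕ-double m = hℕ-unfold (even m)

  hℕ-1 : hℕ 1 ≡ b
  hℕ-1 = hℕ-unfold (odd zero)

  hℕ-odd : ∀ m → hℕ (suc (double (suc m))) ≡ hℕ (suc m) ℕ.+ hℕ (suc (double m))
  hℕ-odd m = hℕ-unfold (odd (suc m))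

  module _ (2≤b : 2 ≤ b) where

    2≤hℕ-odd : ∀ m → 2 ≤ hℕ (suc (double m))
    2≤hℕ-odd zero    = subst (2 ≤_) (sym hℕ-1) 2≤b
    2≤hℕ-odd (suc m) = subst (2 ≤_) (sym (hℕ-odd m)) (≤-trans (2≤hℕ-odd m) (m≤n+m _ _))

    2≤hℕ : ∀ {n} → Parity n → 1 ≤ n → 2 ≤ hℕ n
    2≤hℕ (even (suc m)) _ = subst (2 ≤_) (sym (hℕ-double (suc m))) (s≤s (s≤s z≤n))
    2≤hℕ (odd m)        _ = 2≤hℕ-odd m

    2+double≤hℕ-odd : ∀ m → suc (suc (double m)) ≤ hℕ (suc (double m))
    2+double≤hℕ-odd zero    = 2≤hℕ-odd zero
    2+double≤hℕ-odd (suc m) = subst (suc (suc (double (suc m))) ≤_) (sym (hℕ-odd m))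
      (+-mono-≤ (2≤hℕ (parity (suc m)) (s≤s z≤n)) (2+double≤hℕ-odd m))

  h₀ : ℤ → ℤ
  h₀ (+ n)     = + hℕ n
  h₀ -[1+ _ ] = 1ℤ

  h₀-init : ∀ i → i ℤ.≤ + 0 → h₀ i ≡ 1ℤ
  h₀-init (+ zero)  _            = cong +_ (hℕ-double 0)
  h₀-init (+ suc n) (+≤+ ())
  h₀-init -[1+ _ ]  _            = refl

  h₀-recurrence : 2 ≤ b → ∀ {k} → Parity k →
    h₀ (+ suc (suc k)) ≡ h₀ (+ suc (suc k) - h₀ (+ suc (suc k) - 1ℤ)) + h₀ (+ suc (suc k) - + 2)
  h₀-recurrence 2≤b (even m) = begin
    + hℕ (double (suc m))                                     ≡⟨ cong +_ (hℕ-double (suc m)) ⟩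
    1ℤ + + suc m                                              ≡⟨ sym (cong₂ _+_ first-term (cong +_ (hℕ-double m))) ⟩
    h₀ (+ suc (suc (double m)) - + hℕ (suc (double m))) + + hℕ (double m) ∎
    where
    open ≡-Reasoning
    first-term : h₀ (+ suc (suc (double m)) - + hℕ (suc (double m))) ≡ 1ℤ
    first-term = h₀-init _ (i≤j⇒i-j≤0 (+≤+ (2+double≤hℕ-odd 2≤b m)))
  h₀-recurrence 2≤b (odd m) = begin
    + hℕ (suc (double (suc m)))                               ≡⟨ cong +_ (hℕ-odd m) ⟩
    + (hℕ (suc m) ℕ.+ hℕ (suc (double m)))                    ≡⟨ pos-+ (hℕ (suc m)) _ ⟩
    h₀ (+ suc m) + + hℕ (suc (double m))                      ≡⟨ cong (λ i → h₀ i + + hℕ (suc (double m))) (sym index) ⟩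
    h₀ (+ suc (double (suc m)) - + hℕ (double (suc m))) + + hℕ (suc (double m)) ∎
    where
    open ≡-Reasoning
    index : + suc (double (suc m)) - + hℕ (double (suc m)) ≡ + suc m
    index = trans (cong (λ k → + suc (double (suc m)) - + k) (hℕ-double (suc m))) (1+double[1+m]-[2+m]≡1+m m)

  h₀-IsH : 2 ≤ b → IsH b h₀
  h₀-IsH 2≤b = h₀-init , cong +_ hℕ-1 , recurrence
    where
    recurrence : ∀ i → i ℤ.> + 1 → h₀ i ≡ h₀ (i - h₀ (i - 1ℤ)) + h₀ (i - + 2)
    recurrence (+ suc (suc k)) _           = h₀-recurrence 2≤b (parity k)
    recurrence (+ suc zero)    (+<+ (s≤s ()))
    recurrence (+ zero)        (+<+ ())
    recurrence -[1+ _ ]        ()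

module _ {b : ℕ} (2≤b : 2 ≤ b) {h : ℤ → ℤ} (H : IsH b h) where

  open Construction b
  open ≡-Reasoning

  private
    agrees : ∀ i → h i ≡ h₀ i
    agrees = IsH-unique (<⇒≤ 2≤b) H (h₀-IsH 2≤b)

  IsH-even : ∀ n → h (+ (2 * n)) ≡ + (n ℕ.+ 1)
  IsH-even n = begin
    h (+ (2 * n))        ≡⟨ cong (h ∘ +_) (sym (double≡2* n)) ⟩
    h (+ double n)       ≡⟨ agrees _ ⟩
    + hℕ (double n)      ≡⟨ cong +_ (trans (hℕ-double n) (ℕ.+-comm 1 n)) ⟩
    + (n ℕ.+ 1)          ∎

  IsH-odd : ∀ n → 1 ≤ n → h (+ (2 * n ℕ.+ 1)) ≡ h (+ n) + h (+ (2 * n) - 1ℤ)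
  IsH-odd (suc m) _ = begin
    h (+ (2 * suc m ℕ.+ 1))                   ≡⟨ cong (h ∘ +_) (2*m+1≡1+double (suc m)) ⟩
    h (+ suc (double (suc m)))                ≡⟨ agrees _ ⟩
    + hℕ (suc (double (suc m)))               ≡⟨ cong +_ (hℕ-odd m) ⟩
    + (hℕ (suc m) ℕ.+ hℕ (suc (double m)))    ≡⟨ pos-+ (hℕ (suc m)) _ ⟩
    + hℕ (suc m) + + hℕ (suc (double m))      ≡⟨ sym (cong₂ _+_ (agrees (+ suc m)) (agrees (+ suc (double m)))) ⟩
    h (+ suc m) + h (+ double (suc m) - 1ℤ)   ≡⟨ cong (λ k → h (+ suc m) + h (+ k - 1ℤ)) (double≡2* (suc m)) ⟩
    h (+ suc m) + h (+ (2 * suc m) - 1ℤ)      ∎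

theorem4p1 : (b : ℕ) → 2 ≤ b →
    Σ (ℤ → ℤ) (IsH b) ×
    ((h : ℤ → ℤ) → IsH b h →
      ((n : ℕ) → h (+ (2 * n)) ≡ + (n Data.Nat.+ 1)) ×
      ((n : ℕ) → 1 ≤ n → h (+ (2 * n Data.Nat.+ 1)) ≡ h (+ n) + h (+ (2 * n) - 1ℤ)) ×
      ((n : ℕ) → h (+ (2 * n Data.Nat.+ 1)) ≡ (+ b - 1ℤ) + sumTo h n))
theorem4p1 b 2≤b =
  (Construction.h₀ b , Construction.h₀-IsH b 2≤b) ,
  λ h H → IsH-even 2≤b H , IsH-odd 2≤b H , IsH-odd-sum H (IsH-odd 2≤b H)
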